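{- Let $k\ge 2$ and let $\nu$ be a partition such that $\nu=\mathrm{pre}_k(\lambda)$ for some partition $\lambda$. If $m_\nu(p)>0$ for some prime $p$, then $\lambda$ is the unique partition (of any size) with $\mathrm{pre}_k(\lambda)=\nu$.
   Context: A partition $\lambda=(\lambda_1,\ldots,\lambda_\ell)$ is a weakly decreasing finite sequence of positive integers; $\ell$ is its length. For a positive integer $i$, $m_\lambda(i)$ denotes the number of parts of $\lambda$ equal to $i$. For $k\le \ell$, $\mathrm{pre}_k(\lambda)$ is the partition whose parts are the $\binom{\ell}{k}$ products $\lambda_{i_1}\cdots\lambda_{i_k}$ over all $1\le i_1<\cdots<i_k\le \ell$ (with multiplicity, sorted weakly decreasingly), i.e. the summands of $e_k(\lambda_1,\ldots,\lambda_\ell)$. If $\ell<k$, $\mathrm{pre}_k(\lambda)$ is undefined. -}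

module Defs where

open import Data.Nat using (ℕ; zero; suc; _<_; _≥_; _≟_)
open import Data.Nat.Properties using (≤-decTotalOrder)
open import Data.List using (List; []; _∷_; map; reverse; length; filter)
open import Data.Nat.ListAction using (product)
open import Data.List.Relation.Unary.All using (All)
open import Data.List.Relation.Unary.Linked using (Linked)
open import Data.Product using (_×_)
import Data.List.Sort as Sort

IsPartition : List ℕ → Set
IsPartition xs = Linked _≥_ xs × All (0 <_) xs

mult : List ℕ → ℕ → ℕ
mult xs i = length (filter (i ≟_) xs)

-- all k-element sub-lists (index sets i₁ < … < iₖ), preserving order
choose : ℕ → List ℕ → List (List ℕ)
choose zero    xs       = [] ∷ []
choose (suc k) []       = []
choose (suc k) (x ∷ xs) = map (x ∷_) (choose k xs) Data.List.++ choose (suc k) xs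

sortDesc : List ℕ → List ℕ
sortDesc xs = reverse (Sort.sort ≤-decTotalOrder xs)

-- pre_k(λ): the products over all k-subsets of parts, sorted weakly decreasingly.
-- (Only meaningful when k ≤ length λ; the statement always assumes this.)
pre : ℕ → List ℕ → List ℕ
pre k xs = sortDesc (map product (choose k xs))

-- Write λ = a ++ 1ᵐ with every part of a at least 2. A k-subset of parts with product the prime p
-- uses at most one part of a, so k - 1 ≤ m; the multiplicity of 1 in ν is then C(m, k), which
-- is strictly increasing in m from m = k - 1 on, so m is determined. For t ≥ 2 the multiplicity
-- of t in ν is m_a(t) · C(m, k - 1) plus a count that depends only on the parts of a below t,
-- so by induction on t the parts of a below t are determined, and hence a itself.

module Submission where

open import Defs
open import Algebra.Properties.CommutativeSemigroup using (x∙yz≈y∙xz)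
open import Data.Nat using (ℕ; zero; suc; _+_; _*_; _≟_; _<?_; _≤_; _<_; _≥_; z≤n; s≤s; z<s; >-nonZero; n>1⇒nonTrivial)
open import Data.Nat.Combinatorics using (_C_; nCk+nC[k+1]≡[n+1]C[k+1])
open import Data.Nat.Divisibility using (_∣_; ∣-refl; ∣-trans; m∣m*n)
open import Data.Nat.ListAction using (product)
open import Data.Nat.Primality using (Prime; composite; composite-∣; prime⇒¬composite; prime⇒nonZero)
open import Data.Nat.Properties
open import Data.List using (List; []; _∷_; _++_; length; map; filter; replicate)
open import Data.List.Extrema.Nat using (max; xs≤max)
open import Data.List.Properties using (filter-++; filter-all; filter-none; filter-accept; filter-reject; length-++; length-replicate; map-++; map-cong; map-∘)
open import Data.List.Relation.Unary.All using (All; []; _∷_)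
import Data.List.Relation.Unary.All as All
import Data.List.Relation.Unary.All.Properties as All
open import Data.List.Relation.Unary.Linked using (Linked; []; [-]; _∷_)
import Data.List.Relation.Unary.Linked as Linked
open import Data.List.Relation.Unary.Linked.Properties using (Linked⇒All)
open import Data.List.Relation.Binary.Permutation.Propositional using (_↭_; ↭-trans)
open import Data.List.Relation.Binary.Permutation.Propositional.Properties using (↭-length; filter-↭; ↭-reverse)
import Data.List.Sort as Sort
open import Data.Product using (∃₂; _×_; _,_; proj₁)
open import Data.Sum using (inj₁; inj₂)
open import Function using (_∘_)
open import Relation.Binary using (Rel; tri<; tri≈; tri>)
open import Relation.Binary.PropositionalEquality using (_≡_; _≢_; refl; sym; trans; cong; cong₂; subst; module ≡-Reasoning)
open import Relation.Nullary using (¬_; yes; no; contradiction)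

open ≡-Reasoning

ones : ℕ → List ℕ
ones m = replicate m 1

mult-++ : ∀ xs ys t → mult (xs ++ ys) t ≡ mult xs t + mult ys t
mult-++ xs ys t = trans (cong length (filter-++ (t ≟_) xs ys)) (length-++ (filter (t ≟_) xs))

mult-↭ : ∀ {xs ys} t → xs ↭ ys → mult xs t ≡ mult ys t
mult-↭ t xs↭ys = ↭-length (filter-↭ (t ≟_) xs↭ys)

mult-head-≡ : ∀ t xs → mult (t ∷ xs) t ≡ suc (mult xs t)
mult-head-≡ t xs = cong length (filter-accept (t ≟_) refl)

mult-head-≢ : ∀ {t x} xs → t ≢ x → mult (x ∷ xs) t ≡ mult xs t
mult-head-≢ {t} xs t≢x = cong length (filter-reject (t ≟_) t≢x)

nCk>0 : ∀ {n k} → k ≤ n → 0 < n C k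
nCk>0 {k = zero} _ = z<s
nCk>0 {suc n} {suc k} (s≤s k≤n) =
  <-≤-trans (nCk>0 k≤n) (subst (n C k ≤_) (nCk+nC[k+1]≡[n+1]C[k+1] n k) (m≤m+n (n C k) (n C suc k)))

nC[1+k]<[1+n]C[1+k] : ∀ {n k} → k ≤ n → n C suc k < suc n C suc k
nC[1+k]<[1+n]C[1+k] {n} {k} k≤n =
  subst (n C suc k <_) (nCk+nC[k+1]≡[n+1]C[k+1] n k) (m<n+m (n C suc k) (nCk>0 k≤n))

C-strictMonoˡ : ∀ {m n k} → k ≤ m → m < n → m C suc k < n C suc k
C-strictMonoˡ {n = suc n} k≤m m<1+n with m<1+n⇒m<n∨m≡n m<1+n
... | inj₂ refl = nC[1+k]<[1+n]C[1+k] k≤m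
... | inj₁ m<n  = <-trans (C-strictMonoˡ k≤m m<n) (nC[1+k]<[1+n]C[1+k] (≤-trans k≤m (<⇒≤ m<n)))

C-injectiveˡ : ∀ {m n k} → k ≤ m → k ≤ n → m C suc k ≡ n C suc k → m ≡ n
C-injectiveˡ {m} {n} k≤m k≤n eq with <-cmp m n
... | tri< m<n _ _ = contradiction eq (<⇒≢ (C-strictMonoˡ k≤m m<n))
... | tri≈ _ m≡n _ = m≡n
... | tri> _ _ n<m = contradiction (sym eq) (<⇒≢ (C-strictMonoˡ k≤n n<m))

nonTrivial*nonTrivial∤prime : ∀ {x y p} → 1 < x → 1 < y → Prime p → ¬ (x * y ∣ p)
nonTrivial*nonTrivial∤prime {x} {y} 1<x 1<y p-prime xy∣p =
  prime⇒¬composite p-prime (composite-∣ (composite (m<m*n x y 1<y) (m∣m*n y)) xy∣p)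
  where instance
    _ = n>1⇒nonTrivial 1<x
    _ = >-nonZero (<-trans z<s 1<x)
    _ = prime⇒nonZero p-prime

Linked-++⁻ˡ : ∀ {a r} {A : Set a} {R : Rel A r} xs {ys} → Linked R (xs ++ ys) → Linked R xs
Linked-++⁻ˡ []           _           = []
Linked-++⁻ˡ (x ∷ [])     _           = [-]
Linked-++⁻ˡ (x ∷ y ∷ xs) (Rxy ∷ lnk) = Rxy ∷ Linked-++⁻ˡ (y ∷ xs) lnk

split-ones : ∀ {xs} → IsPartition xs → ∃₂ λ a m → All (1 <_) a × xs ≡ a ++ ones m
split-ones {[]} _ = [] , 0 , [] , refl
split-ones {x ∷ xs} (sorted , x>0 ∷ xs>0) with split-ones (Linked.tail sorted , xs>0) | 1 <? x
... | a , m , a>1 , refl | yes x>1 = x ∷ a , m , x>1 ∷ a>1 , refl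
... | [] , m , _ , refl | no x≯1 = [] , suc m , [] , cong (_∷ ones m) (≤-antisym (≮⇒≥ x≯1) x>0)
... | y ∷ a , m , y>1 ∷ _ , refl | no x≯1 = contradiction (<-≤-trans y>1 (Linked.head sorted)) x≯1

filter-<-injective : ∀ {xs ys} → (∀ t → filter (_<? t) xs ≡ filter (_<? t) ys) → xs ≡ ys
filter-<-injective {xs} {ys} agree = begin
  xs                     ≡⟨ filter-all (_<? bound) (All.++⁻ˡ xs below) ⟨
  filter (_<? bound) xs  ≡⟨ agree bound ⟩
  filter (_<? bound) ys  ≡⟨ filter-all (_<? bound) (All.++⁻ʳ xs below) ⟩
  ys                     ∎
  where
  bound : ℕ
  bound = suc (max 0 (xs ++ ys))
  below : All (_< bound) (xs ++ ys)
  below = All.map s≤s (xs≤max 0 (xs ++ ys))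

filter-<-suc : ∀ t {xs} → Linked _≥_ xs →
               filter (_<? suc t) xs ≡ replicate (mult xs t) t ++ filter (_<? t) xs
filter-<-suc t {[]} _ = refl
filter-<-suc t {y ∷ a} sorted with <-cmp y t
... | tri< y<t _ _ = begin
  filter (_<? suc t) (y ∷ a)  ≡⟨ filter-all (_<? suc t) (All.map m<n⇒m<1+n all<t) ⟩
  y ∷ a                       ≡⟨ filter-all (_<? t) all<t ⟨
  filter (_<? t) (y ∷ a)      ≡⟨ cong (λ n → replicate n t ++ filter (_<? t) (y ∷ a)) no-t ⟨
  replicate (mult (y ∷ a) t) t ++ filter (_<? t) (y ∷ a) ∎
  where
  all<t : All (_< t) (y ∷ a)
  all<t = All.map (λ w≤y → ≤-<-trans w≤y y<t) (Linked⇒All (λ u≥v v≥w → ≤-trans v≥w u≥v) ≤-refl sorted)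
  no-t : mult (y ∷ a) t ≡ 0
  no-t = cong length (filter-none (t ≟_) (All.map (λ w<t → <⇒≢ w<t ∘ sym) all<t))
... | tri≈ _ refl _ = begin
  filter (_<? suc y) (y ∷ a)                       ≡⟨ filter-accept (_<? suc y) ≤-refl ⟩
  y ∷ filter (_<? suc y) a                         ≡⟨ cong (y ∷_) (filter-<-suc y (Linked.tail sorted)) ⟩
  y ∷ replicate (mult a y) y ++ filter (_<? y) a   ≡⟨ cong₂ (λ n l → replicate n y ++ l) (mult-head-≡ y a)
                                                             (filter-reject (_<? y) (<-irrefl refl)) ⟨
  replicate (mult (y ∷ a) y) y ++ filter (_<? y) (y ∷ a) ∎
... | tri> _ _ t<y = begin
  filter (_<? suc t) (y ∷ a)                   ≡⟨ filter-reject (_<? suc t) (<⇒≱ t<y ∘ ≤-pred) ⟩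
  filter (_<? suc t) a                         ≡⟨ filter-<-suc t (Linked.tail sorted) ⟩
  replicate (mult a t) t ++ filter (_<? t) a   ≡⟨ cong₂ (λ n l → replicate n t ++ l) (mult-head-≢ a (<⇒≢ t<y))
                                                         (filter-reject (_<? t) (<⇒≯ t<y)) ⟨
  replicate (mult (y ∷ a) t) t ++ filter (_<? t) (y ∷ a) ∎

productCount : ℕ → ℕ → List ℕ → ℕ → ℕ
productCount x zero    ys       t = mult (x ∷ []) t
productCount x (suc j) []       t = 0
productCount x (suc j) (y ∷ ys) t = productCount (x * y) j ys t + productCount x (suc j) ys t

mult-choose-products : ∀ x j ys t →
                       mult (map (λ s → x * product s) (choose j ys)) t ≡ productCount x j ys t
mult-choose-products x zero    ys       t = cong (λ z → mult (z ∷ []) t) (*-identityʳ x)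
mult-choose-products x (suc j) []       t = refl
mult-choose-products x (suc j) (y ∷ ys) t = begin
  mult (map f (map (y ∷_) with-y ++ without-y)) t
    ≡⟨ cong (λ l → mult l t) (map-++ f (map (y ∷_) with-y) without-y) ⟩
  mult (map f (map (y ∷_) with-y) ++ map f without-y) t
    ≡⟨ mult-++ (map f (map (y ∷_) with-y)) (map f without-y) t ⟩
  mult (map f (map (y ∷_) with-y)) t + mult (map f without-y) t
    ≡⟨ cong₂ _+_ (trans (cong (λ l → mult l t) absorb-y) (mult-choose-products (x * y) j ys t))
                 (mult-choose-products x (suc j) ys t) ⟩
  productCount (x * y) j ys t + productCount x (suc j) ys t ∎
  where
  f : List ℕ → ℕ
  f s = x * product s
  with-y : List (List ℕ)
  with-y = choose j ys
  without-y : List (List ℕ)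
  without-y = choose (suc j) ys
  absorb-y : map f (map (y ∷_) with-y) ≡ map (λ s → (x * y) * product s) with-y
  absorb-y = trans (sym (map-∘ with-y)) (map-cong (λ s → sym (*-assoc x y (product s))) with-y)

mult-pre : ∀ k xs t → mult (pre k xs) t ≡ productCount 1 k xs t
mult-pre k xs t = begin
  mult (pre k xs) t                              ≡⟨ mult-↭ t sorted↭ ⟩
  mult (map product (choose k xs)) t             ≡⟨ cong (λ l → mult l t) (map-cong (sym ∘ *-identityˡ ∘ product) (choose k xs)) ⟩
  mult (map (λ s → 1 * product s) (choose k xs)) t ≡⟨ mult-choose-products 1 k xs t ⟩
  productCount 1 k xs t                          ∎
  where
  sorted↭ : pre k xs ↭ map product (choose k xs)
  sorted↭ = ↭-trans (↭-reverse _) (Sort.sort-↭ ≤-decTotalOrder (map product (choose k xs)))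

productCount-< : ∀ {x t} j {ys} → All (0 <_) ys → t < x → productCount x j ys t ≡ 0
productCount-< zero    _           t<x = mult-head-≢ [] (<⇒≢ t<x)
productCount-< (suc j) {[]}     _  _   = refl
productCount-< {x} (suc j) {y ∷ _} (y>0 ∷ ys>0) t<x =
  cong₂ _+_ (productCount-< j ys>0 (<-≤-trans t<x (m≤m*n x y ⦃ >-nonZero y>0 ⦄)))
            (productCount-< (suc j) ys>0 t<x)

∤⇒productCount≡0 : ∀ {x t} j ys → ¬ (x ∣ t) → productCount x j ys t ≡ 0
∤⇒productCount≡0 {x} zero    _        x∤t = mult-head-≢ [] (λ t≡x → x∤t (subst (x ∣_) (sym t≡x) ∣-refl))
∤⇒productCount≡0     (suc j) []       _   = refl
∤⇒productCount≡0     (suc j) (y ∷ ys) x∤t =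
  cong₂ _+_ (∤⇒productCount≡0 j ys (x∤t ∘ ∣-trans (m∣m*n y))) (∤⇒productCount≡0 (suc j) ys x∤t)

length<⇒productCount≡0 : ∀ {x t} j ys → length ys < j → productCount x j ys t ≡ 0
length<⇒productCount≡0 (suc j) []       _            = refl
length<⇒productCount≡0 (suc j) (y ∷ ys) (s≤s |ys|<j) =
  cong₂ _+_ (length<⇒productCount≡0 j ys |ys|<j) (length<⇒productCount≡0 (suc j) ys (m<n⇒m<1+n |ys|<j))

productCount-filter : ∀ {x t u} j {ys} → All (0 <_) ys → t < x * u →
                      productCount x j ys t ≡ productCount x j (filter (_<? u) ys) t
productCount-filter zero    _ _ = refl
productCount-filter (suc j) {[]} _ _ = refl
productCount-filter {x} {t} {u} (suc j) {y ∷ ys} (y>0 ∷ ys>0) t<xu with y <? u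
... | yes y<u = begin
  productCount (x * y) j ys t + productCount x (suc j) ys t
    ≡⟨ cong₂ _+_ (productCount-filter j ys>0 (<-≤-trans t<xu (*-monoˡ-≤ u (m≤m*n x y ⦃ >-nonZero y>0 ⦄))))
                 (productCount-filter (suc j) ys>0 t<xu) ⟩
  productCount x (suc j) (y ∷ filter (_<? u) ys) t
    ≡⟨ cong (λ l → productCount x (suc j) l t) (filter-accept (_<? u) y<u) ⟨
  productCount x (suc j) (filter (_<? u) (y ∷ ys)) t ∎
... | no y≮u = begin
  productCount (x * y) j ys t + productCount x (suc j) ys t
    ≡⟨ cong₂ _+_ (productCount-< j ys>0 (<-≤-trans t<xu (*-monoʳ-≤ x (≮⇒≥ y≮u))))
                 (productCount-filter (suc j) ys>0 t<xu) ⟩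
  productCount x (suc j) (filter (_<? u) ys) t
    ≡⟨ cong (λ l → productCount x (suc j) l t) (filter-reject (_<? u) y≮u) ⟨
  productCount x (suc j) (filter (_<? u) (y ∷ ys)) t ∎

parts>1++ones>0 : ∀ {a} m → All (1 <_) a → All (0 <_) (a ++ ones m)
parts>1++ones>0 m a>1 = All.++⁺ (All.map (<-trans z<s) a>1) (All.replicate⁺ m z<s)

filter-<-++-ones : ∀ {t} a m → 1 < t → filter (_<? t) (a ++ ones m) ≡ filter (_<? t) a ++ ones m
filter-<-++-ones {t} a m t>1 =
  trans (filter-++ (_<? t) a (ones m)) (cong (filter (_<? t) a ++_) (filter-all (_<? t) (All.replicate⁺ m t>1)))

productCount-ones : ∀ {x} j m {a} → 0 < x → All (1 <_) a → productCount x j (a ++ ones m) x ≡ m C j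
productCount-ones {x} zero    _       _   _  = mult-head-≡ x []
productCount-ones     (suc j) zero    {[]} _ _ = refl
productCount-ones {x} (suc j) (suc m) {[]} x>0 [] rewrite *-identityʳ x =
  trans (cong₂ _+_ (productCount-ones j m x>0 []) (productCount-ones (suc j) m x>0 []))
        (nCk+nC[k+1]≡[n+1]C[k+1] m j)
productCount-ones {x} (suc j) m {y ∷ _} x>0 (y>1 ∷ a>1) =
  cong₂ _+_ (productCount-< j (parts>1++ones>0 m a>1) (m<m*n x y ⦃ >-nonZero x>0 ⦄ y>1))
            (productCount-ones (suc j) m x>0 a>1)

productCount-prime≡0 : ∀ {x t} j m {a} → Prime t → 1 < x → All (1 <_) a → m < j →
                       productCount x j (a ++ ones m) t ≡ 0
productCount-prime≡0 j m {[]} _ _ _ m<j =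
  length<⇒productCount≡0 j (ones m) (subst (_< j) (sym (length-replicate m)) m<j)
productCount-prime≡0 (suc j) m {y ∷ a} t-prime x>1 (y>1 ∷ a>1) m<1+j =
  cong₂ _+_ (∤⇒productCount≡0 j (a ++ ones m) (nonTrivial*nonTrivial∤prime x>1 y>1 t-prime))
            (productCount-prime≡0 (suc j) m t-prime x>1 a>1 m<1+j)

productCount₁-prime≡0 : ∀ {t} j m {a} → Prime t → All (1 <_) a → suc m < j →
                        productCount 1 j (a ++ ones m) t ≡ 0
productCount₁-prime≡0 j m {[]} _ _ 1+m<j =
  length<⇒productCount≡0 j (ones m) (subst (_< j) (sym (length-replicate m)) (<-trans (n<1+n m) 1+m<j))
productCount₁-prime≡0 (suc j) m {y ∷ a} t-prime (y>1 ∷ a>1) 1+m<1+j =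
  cong₂ _+_ (productCount-prime≡0 j m t-prime (subst (1 <_) (sym (*-identityˡ y)) y>1) a>1 (≤-pred 1+m<1+j))
            (productCount₁-prime≡0 (suc j) m t-prime a>1 1+m<1+j)

productCount₁-prime>0⇒≤1+m : ∀ {t} j m {a} → Prime t → All (1 <_) a →
                             0 < productCount 1 j (a ++ ones m) t → j ≤ suc m
productCount₁-prime>0⇒≤1+m j m t-prime a>1 count>0 =
  ≮⇒≥ (λ 1+m<j → <⇒≢ count>0 (sym (productCount₁-prime≡0 j m t-prime a>1 1+m<j)))

-- For t ≥ 2 a sub-list with product t contains either the single part t of a, completed by
-- k ones, or only parts of a below t.
productCount-by-parts-below : ∀ {t} k m {a} → 1 < t → All (1 <_) a →
  productCount 1 (suc k) (a ++ ones m) t ≡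
  mult a t * (m C k) + productCount 1 (suc k) (filter (_<? t) a ++ ones m) t
productCount-by-parts-below k m {[]} _ _ = refl
productCount-by-parts-below {t} k m {y ∷ a} t>1 (y>1 ∷ a>1) with <-cmp y t
... | tri< y<t _ _ = begin
  productCount (1 * y) k (a ++ ones m) t + productCount 1 (suc k) (a ++ ones m) t
    ≡⟨ cong₂ _+_ y-below (productCount-by-parts-below k m t>1 a>1) ⟩
  productCount (1 * y) k (a<t ++ ones m) t + (mult a t * (m C k) + rest)
    ≡⟨ x∙yz≈y∙xz +-commutativeSemigroup _ (mult a t * (m C k)) rest ⟩
  mult a t * (m C k) + (productCount (1 * y) k (a<t ++ ones m) t + rest)
    ≡⟨ cong₂ (λ n l → n * (m C k) + productCount 1 (suc k) (l ++ ones m) t)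
             (mult-head-≢ a (<⇒≢ y<t ∘ sym)) (filter-accept (_<? t) y<t) ⟨
  mult (y ∷ a) t * (m C k) + productCount 1 (suc k) (filter (_<? t) (y ∷ a) ++ ones m) t ∎
  where
  a<t : List ℕ
  a<t = filter (_<? t) a
  rest : ℕ
  rest = productCount 1 (suc k) (a<t ++ ones m) t
  t<yt : t < 1 * y * t
  t<yt = <-≤-trans (m<m*n t (1 * y) ⦃ >-nonZero (<-trans z<s t>1) ⦄ (subst (1 <_) (sym (*-identityˡ y)) y>1))
                   (≤-reflexive (*-comm t (1 * y)))
  y-below : productCount (1 * y) k (a ++ ones m) t ≡ productCount (1 * y) k (a<t ++ ones m) t
  y-below = trans (productCount-filter k (parts>1++ones>0 m a>1) t<yt)
                  (cong (λ l → productCount (1 * y) k l t) (filter-<-++-ones a m t>1))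
... | tri≈ _ refl _ = begin
  productCount (1 * y) k (a ++ ones m) y + productCount 1 (suc k) (a ++ ones m) y
    ≡⟨ cong₂ _+_ y-itself (productCount-by-parts-below k m t>1 a>1) ⟩
  m C k + (mult a y * (m C k) + productCount 1 (suc k) (filter (_<? y) a ++ ones m) y)
    ≡⟨ +-assoc (m C k) _ _ ⟨
  suc (mult a y) * (m C k) + productCount 1 (suc k) (filter (_<? y) a ++ ones m) y
    ≡⟨ cong₂ (λ n l → n * (m C k) + productCount 1 (suc k) (l ++ ones m) y)
             (mult-head-≡ y a) (filter-reject (_<? y) (<-irrefl refl)) ⟨
  mult (y ∷ a) y * (m C k) + productCount 1 (suc k) (filter (_<? y) (y ∷ a) ++ ones m) y ∎
  where
  y-itself : productCount (1 * y) k (a ++ ones m) y ≡ m C k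
  y-itself = trans (cong (λ x → productCount x k (a ++ ones m) y) (*-identityˡ y))
                   (productCount-ones k m (<-trans z<s y>1) a>1)
... | tri> _ _ t<y = begin
  productCount (1 * y) k (a ++ ones m) t + productCount 1 (suc k) (a ++ ones m) t
    ≡⟨ cong₂ _+_ (productCount-< k (parts>1++ones>0 m a>1) (subst (t <_) (sym (*-identityˡ y)) t<y))
                 (productCount-by-parts-below k m t>1 a>1) ⟩
  mult a t * (m C k) + productCount 1 (suc k) (filter (_<? t) a ++ ones m) t
    ≡⟨ cong₂ (λ n l → n * (m C k) + productCount 1 (suc k) (l ++ ones m) t)
             (mult-head-≢ a (<⇒≢ t<y)) (filter-reject (_<? t) (<⇒≯ t<y)) ⟨
  mult (y ∷ a) t * (m C k) + productCount 1 (suc k) (filter (_<? t) (y ∷ a) ++ ones m) t ∎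

filter-<-[] : ∀ {t a} → t ≤ 2 → All (1 <_) a → filter (_<? t) a ≡ []
filter-<-[] {t} t≤2 a>1 = filter-none (_<? t) (All.map (λ y>1 y<t → <⇒≱ y<t (≤-trans t≤2 y>1)) a>1)

module _ {k m : ℕ} {a b : List ℕ} (k≤m : k ≤ m) (a>1 : All (1 <_) a) (b>1 : All (1 <_) b)
         (a-sorted : Linked _≥_ a) (b-sorted : Linked _≥_ b)
         (same-counts : ∀ t → productCount 1 (suc k) (a ++ ones m) t ≡ productCount 1 (suc k) (b ++ ones m) t)
         where

  filter-<-agree : ∀ t → filter (_<? t) a ≡ filter (_<? t) b
  filter-<-agree zero = trans (filter-<-[] z≤n a>1) (sym (filter-<-[] z≤n b>1))
  filter-<-agree (suc t) with 1 <? t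
  ... | no t≯1 = trans (filter-<-[] (s≤s (≮⇒≥ t≯1)) a>1) (sym (filter-<-[] (s≤s (≮⇒≥ t≯1)) b>1))
  ... | yes t>1 = begin
    filter (_<? suc t) a                        ≡⟨ filter-<-suc t a-sorted ⟩
    replicate (mult a t) t ++ filter (_<? t) a  ≡⟨ cong₂ (λ n l → replicate n t ++ l) same-mult below ⟩
    replicate (mult b t) t ++ filter (_<? t) b  ≡⟨ filter-<-suc t b-sorted ⟨
    filter (_<? suc t) b                        ∎
    where
    below : filter (_<? t) a ≡ filter (_<? t) b
    below = filter-<-agree t
    rest : List ℕ → ℕ
    rest c = productCount 1 (suc k) (filter (_<? t) c ++ ones m) t
    same-mult : mult a t ≡ mult b t
    same-mult = *-cancelʳ-≡ (mult a t) (mult b t) (m C k) ⦃ >-nonZero (nCk>0 k≤m) ⦄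
      (+-cancelʳ-≡ (rest a) (mult a t * (m C k)) (mult b t * (m C k)) (begin
        mult a t * (m C k) + rest a   ≡⟨ productCount-by-parts-below k m t>1 a>1 ⟨
        productCount 1 (suc k) (a ++ ones m) t ≡⟨ same-counts t ⟩
        productCount 1 (suc k) (b ++ ones m) t ≡⟨ productCount-by-parts-below k m t>1 b>1 ⟩
        mult b t * (m C k) + rest b   ≡⟨ cong (λ l → mult b t * (m C k) + productCount 1 (suc k) (l ++ ones m) t) below ⟨
        mult b t * (m C k) + rest a   ∎))

pre≡⇒productCount≡ : ∀ k {xs ys} → pre k xs ≡ pre k ys → ∀ t → productCount 1 k xs t ≡ productCount 1 k ys t
pre≡⇒productCount≡ k {xs} {ys} pre≡ t = begin
  productCount 1 k xs t   ≡⟨ mult-pre k xs t ⟨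
  mult (pre k xs) t       ≡⟨ cong (λ l → mult l t) pre≡ ⟩
  mult (pre k ys) t       ≡⟨ mult-pre k ys t ⟩
  productCount 1 k ys t   ∎

++-ones-unique : ∀ k {a b m n} → All (1 <_) a → All (1 <_) b → Linked _≥_ a → Linked _≥_ b → k ≤ m → k ≤ n →
                 (∀ t → productCount 1 (suc k) (a ++ ones m) t ≡ productCount 1 (suc k) (b ++ ones n) t) →
                 a ++ ones m ≡ b ++ ones n
++-ones-unique k {a} {b} {m} {n} a>1 b>1 a-sorted b-sorted k≤m k≤n same-counts =
  cong₂ (λ c r → c ++ ones r) (filter-<-injective (filter-<-agree k≤m a>1 b>1 a-sorted b-sorted same-counts′)) m≡n
  where
  m≡n : m ≡ n
  m≡n = C-injectiveˡ k≤m k≤n (begin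
    m C suc k                                ≡⟨ productCount-ones (suc k) m z<s a>1 ⟨
    productCount 1 (suc k) (a ++ ones m) 1   ≡⟨ same-counts 1 ⟩
    productCount 1 (suc k) (b ++ ones n) 1   ≡⟨ productCount-ones (suc k) n z<s b>1 ⟩
    n C suc k                                ∎)
  same-counts′ : ∀ t → productCount 1 (suc k) (a ++ ones m) t ≡ productCount 1 (suc k) (b ++ ones m) t
  same-counts′ t = trans (same-counts t) (cong (λ r → productCount 1 (suc k) (b ++ ones r) t) (sym m≡n))

lemma2p5 : (k : ℕ) → 2 ≤ k → (ν lam : List ℕ) → IsPartition lam → k ≤ length lam →
           pre k lam ≡ ν → (p : ℕ) → Prime p → 0 < mult ν p →
           (μ : List ℕ) → IsPartition μ → k ≤ length μ → pre k μ ≡ ν → μ ≡ lam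
lemma2p5 (suc k) (s≤s _) ν lam λ-partition _ refl p p-prime ν[p]>0 μ μ-partition _ pre[μ]≡ν
  with split-ones λ-partition | split-ones μ-partition
... | a , m , a>1 , refl | b , n , b>1 , refl =
  ++-ones-unique k b>1 a>1 (Linked-++⁻ˡ b (proj₁ μ-partition)) (Linked-++⁻ˡ a (proj₁ λ-partition))
                 k≤n k≤m same-counts
  where
  same-counts : ∀ t → productCount 1 (suc k) (b ++ ones n) t ≡ productCount 1 (suc k) (a ++ ones m) t
  same-counts = pre≡⇒productCount≡ (suc k) {b ++ ones n} {a ++ ones m} pre[μ]≡ν
  p-in-ν : 0 < productCount 1 (suc k) (a ++ ones m) p
  p-in-ν = subst (0 <_) (mult-pre (suc k) (a ++ ones m) p) ν[p]>0
  k≤m : k ≤ m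
  k≤m = ≤-pred (productCount₁-prime>0⇒≤1+m (suc k) m p-prime a>1 p-in-ν)
  k≤n : k ≤ n
  k≤n = ≤-pred (productCount₁-prime>0⇒≤1+m (suc k) n p-prime b>1 (subst (0 <_) (sym (same-counts p)) p-in-ν))
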